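{- Let $f:\{ -1,1\}^n\to\{ -1,1\}$ be computed by a read-$k$ decision tree $T$. Then $\mathrm{Cov}[T]\le (k-1)\cdot\mathrm{Var}[f]$.
   Context: Decision trees are assumed to query no variable more than once along any root-to-leaf path; read-$k$ means no variable is queried at more than $k$ nodes. All expectations are under the uniform distribution on $\{ -1,1\}^n$. $\mathrm{Cov}[g,h]=\mathbb{E}[(g-\mathbb{E}g)(h-\mathbb{E}h)]$. For an internal node $v$, $\mathrm{Cov}[v]=\mathrm{Cov}[g_v,h_v]$ where $g_v,h_v$ are computed by the left ($+1$ edge) and right ($-1$ edge) subtrees of $v$; $d(v)$ is its depth (root at depth 0); $\mathrm{Cov}[T]=\sum_v\mathrm{Cov}[v]2^{ -d(v)}$ over internal nodes. -}

module Defs where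

open import Data.Nat as ℕ using (ℕ; zero; suc)
open import Data.Fin using (Fin)
open import Data.Vec using (Vec; []; _∷_; lookup)
open import Data.Integer using (+_; -[1+_])
open import Data.Rational using (ℚ; 0ℚ; 1ℚ; ½; _+_; _*_; _-_; _/_)
open import Data.Empty using (⊥)
open import Relation.Nullary using (yes; no)
import Data.Fin as F

data PM : Set where
  pos neg : PM

toℚ : PM → ℚ
toℚ pos = 1ℚ
toℚ neg = -[1+ 0 ] / 1

data DT (n : ℕ) : Set where
  leaf : PM → DT n
  node : Fin n → DT n → DT n → DT n

eval : ∀ {n} → DT n → Vec PM n → PM
eval (leaf b) x = b
eval (node i l r) x with lookup x i
... | pos = eval l x
... | neg = eval r x

data Queries {n : ℕ} (i : Fin n) : DT n → Set where
  here  : ∀ {l r} → Queries i (node i l r)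
  left  : ∀ {j l r} → Queries i l → Queries i (node j l r)
  right : ∀ {j l r} → Queries i r → Queries i (node j l r)

data NoRepeat {n : ℕ} : DT n → Set where
  leaf : ∀ {b} → NoRepeat (leaf b)
  node : ∀ {i l r} → (Queries i l → ⊥) → (Queries i r → ⊥) →
         NoRepeat l → NoRepeat r → NoRepeat (node i l r)

count : ∀ {n} → Fin n → DT n → ℕ
count i (leaf b) = 0
count i (node j l r) with i F.≟ j
... | yes _ = suc (count i l ℕ.+ count i r)
... | no _ = count i l ℕ.+ count i r

ReadK : ∀ {n} → ℕ → DT n → Set
ReadK {n} k T = ∀ (i : Fin n) → count i T ℕ.≤ k

E : ∀ n → (Vec PM n → ℚ) → ℚ
E zero f = f []
E (suc n) f = ½ * (E n (λ x → f (pos ∷ x)) + E n (λ x → f (neg ∷ x)))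

Cov : ∀ n → (Vec PM n → ℚ) → (Vec PM n → ℚ) → ℚ
Cov n g h = E n (λ x → (g x - E n g) * (h x - E n h))

Var : ∀ n → (Vec PM n → ℚ) → ℚ
Var n f = E n (λ x → (f x - E n f) * (f x - E n f))

_^_ : ℚ → ℕ → ℚ
q ^ zero = 1ℚ
q ^ suc d = q * (q ^ d)

-- Sum over internal nodes v of the subtree (located at depth d) of
-- Cov[g_v, h_v] · 2^{-d(v)}.
CovAt : ∀ {n} → ℕ → DT n → ℚ
CovAt d (leaf b) = 0ℚ
CovAt {n} d (node i l r) =
  Cov n (λ x → toℚ (eval l x)) (λ x → toℚ (eval r x)) * (½ ^ d)
  + CovAt (suc d) l + CovAt (suc d) r

CovT : ∀ {n} → DT n → ℚ
CovT T = CovAt 0 T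

module Submission where

-- For weights w on the variables let  WVar w T = Σ_v w(x_v) · gap_v · 2^{-d(v)},
-- where  gap_v = ((E g_v - E h_v) / 2)²  for the subfunctions g_v, h_v below v.
-- With w ≡ 1 this is the classical variance decomposition  Var[T] = WVar 1 T.
--
-- The key estimate concerns two trees g and h.  Averaging g over every
-- variable that h never reads does not change Cov[g,h] (h ignores those
-- variables), and symmetrically for h; after that Cov ≤ ½Var + ½Var applies.
-- Averaging a tree over a set J of variables kills the gap terms of nodes
-- reading a variable of J and does not increase the others, so
-- Var[avg_J g] ≤ WVar w g  for every w ≥ 0 with w ≥ 1 outside J; taking for w
-- the number of reads in h gives
--     Cov[g,h] ≤ ½ WVar (reads h) g + ½ WVar (reads g) h.
-- Applying this at every node v of T (with g, h the two subtrees of v) and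
-- inducting on T yields  Cov[T] ≤ WVar (reads T - 1) T, since the reads of one
-- subtree plus those of its sibling are at most the reads of the parent.
-- Read-k bounds this by (k - 1) · WVar 1 T = (k - 1) · Var[f].

open import Defs
open import Data.Nat using (ℕ)
open import Data.Vec using (Vec)
open import Data.Rational using (_≤_; _*_; _-_; 1ℚ)
open import Data.Rational using (_/_)
open import Data.Integer using (+_)
open import Relation.Binary.PropositionalEquality using (_≡_)

open import Data.Nat using (zero; suc)
import Data.Nat as ℕ
import Data.Nat.Properties as ℕP
open import Data.Fin using (Fin; zero; suc) renaming (_≟_ to _≟ᶠ_)
open import Data.Vec using ([]; _∷_; lookup; _[_]≔_)
import Data.Vec.Properties as VecP
open import Data.List using (List; []; _∷_; filter; allFin)
open import Data.List.Relation.Unary.Any using (here; there)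
open import Data.List.Membership.Propositional using (_∈_)
open import Data.List.Membership.Propositional.Properties using (∈-filter⁺; ∈-filter⁻; ∈-allFin)
import Data.List.Membership.DecPropositional as DecMembership
open import Data.Rational using (ℚ; 0ℚ; ½; _+_; -_; toℚᵘ; nonNegative; nonPositive)
open import Data.Rational.Properties
open import Data.Rational.Solver using (module +-*-Solver)
import Data.Rational.Unnormalised as ℚᵘ
import Data.Rational.Unnormalised.Properties as ℚᵘP
import Data.Integer as ℤ
import Data.Integer.Properties as ℤP
open import Data.Empty using (⊥-elim)
open import Data.Sum using (inj₁; inj₂)
open import Data.Product using (proj₂)
open import Relation.Nullary using (¬_; yes; no)
open import Relation.Binary.PropositionalEquality
  using (refl; sym; trans; cong; cong₂; subst; subst₂; _≢_; module ≡-Reasoning)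
open +-*-Solver

sq : ℚ → ℚ
sq a = a * a

mean : ℚ → ℚ → ℚ
mean a b = ½ * (a + b)

*-nonneg : ∀ {a b} → 0ℚ ≤ a → 0ℚ ≤ b → 0ℚ ≤ a * b
*-nonneg {a} {b} p q = nonNegative⁻¹ _ {{nonNeg*nonNeg⇒nonNeg a {{nonNegative p}} b {{nonNegative q}}}}

sq-nonneg : ∀ a → 0ℚ ≤ sq a
sq-nonneg a with ≤-total 0ℚ a
... | inj₁ 0≤a = *-nonneg 0≤a 0≤a
... | inj₂ a≤0 = nonNegative⁻¹ _ {{nonPos*nonPos⇒nonPos a {{nonPositive a≤0}} a {{nonPositive a≤0}}}}

½-nonneg : 0ℚ ≤ ½
½-nonneg = nonNegative⁻¹ ½

½*-mono : ∀ {a b} → a ≤ b → ½ * a ≤ ½ * b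
½*-mono = *-monoˡ-≤-nonNeg ½

≤-by-slack : ∀ {a b} c → b ≡ a + c → 0ℚ ≤ c → a ≤ b
≤-by-slack {a} c b≡a+c 0≤c = subst₂ _≤_ (+-identityʳ a) (sym b≡a+c) (+-monoʳ-≤ a 0≤c)

≤⇒0≤difference : ∀ {a b} → a ≤ b → 0ℚ ≤ b - a
≤⇒0≤difference {a} {b} a≤b = subst (_≤ b - a) (+-inverseʳ a) (+-monoˡ-≤ (- a) a≤b)

≤-+-nonneg-product : ∀ a {c d} → 0ℚ ≤ c → 0ℚ ≤ d → a ≤ a + c * d
≤-+-nonneg-product a 0≤c 0≤d = ≤-by-slack _ refl (*-nonneg 0≤c 0≤d)

ι : ℕ → ℚ
ι zero = 0ℚ
ι (suc k) = 1ℚ + ι k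

ι-nonneg : ∀ k → 0ℚ ≤ ι k
ι-nonneg zero = ≤-refl
ι-nonneg (suc k) = +-mono-≤ (nonNegative⁻¹ 1ℚ) (ι-nonneg k)

ι-mono : ∀ {a b} → a ℕ.≤ b → ι a ≤ ι b
ι-mono {zero} {b} _ = ι-nonneg b
ι-mono (ℕ.s≤s a≤b) = +-monoʳ-≤ 1ℚ (ι-mono a≤b)

ι-+ : ∀ a b → ι (a ℕ.+ b) ≡ ι a + ι b
ι-+ zero b = sym (+-identityˡ (ι b))
ι-+ (suc a) b = trans (cong (_+_ 1ℚ) (ι-+ a b)) (sym (+-assoc 1ℚ (ι a) (ι b)))

ι-positive : ∀ {k} → 1 ℕ.≤ k → 1ℚ ≤ ι k
ι-positive {suc k} _ = ≤-by-slack (ι k) refl (ι-nonneg k)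

fromℕ-suc : ∀ k → (+ suc k) / 1 ≡ 1ℚ + (+ k) / 1
fromℕ-suc k = toℚᵘ-injective (begin
  toℚᵘ ((+ suc k) / 1)           ≈⟨ toℚᵘ-fromℚᵘ (ℚᵘ.mkℚᵘ (+ suc k) 0) ⟩
  ℚᵘ.mkℚᵘ (+ suc k) 0            ≈⟨ unnormalised-step ⟩
  ℚᵘ.1ℚᵘ ℚᵘ.+ ℚᵘ.mkℚᵘ (+ k) 0     ≈⟨ ℚᵘP.+-congʳ ℚᵘ.1ℚᵘ (toℚᵘ-fromℚᵘ (ℚᵘ.mkℚᵘ (+ k) 0)) ⟨
  toℚᵘ 1ℚ ℚᵘ.+ toℚᵘ ((+ k) / 1)  ≈⟨ toℚᵘ-homo-+ 1ℚ ((+ k) / 1) ⟨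
  toℚᵘ (1ℚ + (+ k) / 1)          ∎)
  where
  open ℚᵘP.≃-Reasoning
  unnormalised-step : ℚᵘ.mkℚᵘ (+ suc k) 0 ℚᵘ.≃ (ℚᵘ.1ℚᵘ ℚᵘ.+ ℚᵘ.mkℚᵘ (+ k) 0)
  unnormalised-step = ℚᵘ.*≡* (trans (ℤP.*-identityʳ (+ suc k))
    (sym (trans (ℤP.*-identityʳ _) (cong (ℤ._+_ (+ 1)) (ℤP.*-identityʳ (+ k))))))

ι≡fromℕ : ∀ k → ι k ≡ (+ k) / 1
ι≡fromℕ zero = refl
ι≡fromℕ (suc k) = trans (cong (_+_ 1ℚ) (ι≡fromℕ k)) (sym (fromℕ-suc k))

Fun : ℕ → Set
Fun n = Vec PM n → ℚ

_⁺ _⁻ : ∀ {n} → Fun (suc n) → Fun n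
(f ⁺) x = f (pos ∷ x)
(f ⁻) x = f (neg ∷ x)

E-cong : ∀ n {f g : Fun n} → (∀ x → f x ≡ g x) → E n f ≡ E n g
E-cong zero f≗g = f≗g []
E-cong (suc n) f≗g = cong₂ mean (E-cong n (λ x → f≗g (pos ∷ x))) (E-cong n (λ x → f≗g (neg ∷ x)))

E-+ : ∀ n (f g : Fun n) → E n (λ x → f x + g x) ≡ E n f + E n g
E-+ zero f g = refl
E-+ (suc n) f g = trans
  (cong₂ mean (E-+ n (f ⁺) (g ⁺)) (E-+ n (f ⁻) (g ⁻)))
  (mean-+ (E n (f ⁺)) (E n (g ⁺)) (E n (f ⁻)) (E n (g ⁻)))
  where
  mean-+ : ∀ a b c d → mean (a + b) (c + d) ≡ mean a c + mean b d
  mean-+ = solve 4 (λ a b c d → con ½ :* ((a :+ b) :+ (c :+ d)) := con ½ :* (a :+ c) :+ con ½ :* (b :+ d)) refl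

E-scale : ∀ n c (f : Fun n) → E n (λ x → c * f x) ≡ c * E n f
E-scale zero c f = refl
E-scale (suc n) c f = trans
  (cong₂ mean (E-scale n c (f ⁺)) (E-scale n c (f ⁻)))
  (mean-scale c (E n (f ⁺)) (E n (f ⁻)))
  where
  mean-scale : ∀ c a b → mean (c * a) (c * b) ≡ c * mean a b
  mean-scale = solve 3 (λ c a b → con ½ :* (c :* a :+ c :* b) := c :* (con ½ :* (a :+ b))) refl

mean-self : ∀ c → mean c c ≡ c
mean-self = solve 1 (λ c → con ½ :* (c :+ c) := c) refl

E-const : ∀ n c → E n (λ _ → c) ≡ c
E-const zero c = refl
E-const (suc n) c = trans (cong₂ mean (E-const n c) (E-const n c)) (mean-self c)

E-- : ∀ n (f g : Fun n) → E n (λ x → f x - g x) ≡ E n f - E n g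
E-- zero f g = refl
E-- (suc n) f g = trans
  (cong₂ mean (E-- n (f ⁺) (g ⁺)) (E-- n (f ⁻) (g ⁻)))
  (mean-- (E n (f ⁺)) (E n (g ⁺)) (E n (f ⁻)) (E n (g ⁻)))
  where
  mean-- : ∀ a b c d → mean (a - b) (c - d) ≡ mean a c - mean b d
  mean-- = solve 4 (λ a b c d → con ½ :* ((a :- b) :+ (c :- d)) := con ½ :* (a :+ c) :- con ½ :* (b :+ d)) refl

E-nonneg : ∀ n (f : Fun n) → (∀ x → 0ℚ ≤ f x) → 0ℚ ≤ E n f
E-nonneg zero f 0≤f = 0≤f []
E-nonneg (suc n) f 0≤f = *-nonneg ½-nonneg
  (+-mono-≤ (E-nonneg n (f ⁺) (λ x → 0≤f (pos ∷ x))) (E-nonneg n (f ⁻) (λ x → 0≤f (neg ∷ x))))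

E-mono : ∀ n (f g : Fun n) → (∀ x → f x ≤ g x) → E n f ≤ E n g
E-mono n f g f≤g = ≤-by-slack (E n (λ x → g x - f x))
  (trans (difference-split (E n f) (E n g)) (cong (_+_ (E n f)) (sym (E-- n g f))))
  (E-nonneg n _ (λ x → ≤⇒0≤difference (f≤g x)))
  where
  difference-split : ∀ a b → b ≡ a + (b - a)
  difference-split = solve 2 (λ a b → b := a :+ (b :- a)) refl

E-split : ∀ n (j : Fin n) (f : Fun n) →
  E n f ≡ mean (E n (λ x → f (x [ j ]≔ pos))) (E n (λ x → f (x [ j ]≔ neg)))
E-split (suc n) zero f = split-first (E n (f ⁺)) (E n (f ⁻))
  where
  split-first : ∀ a b → mean a b ≡ mean (mean a a) (mean b b)
  split-first = solve 2 (λ a b → con ½ :* (a :+ b) := con ½ :* (con ½ :* (a :+ a) :+ con ½ :* (b :+ b))) refl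
E-split (suc n) (suc j) f =
  trans (cong₂ mean (E-split n j (f ⁺)) (E-split n j (f ⁻)))
        (mean-interchange (E n (λ x → f (pos ∷ (x [ j ]≔ pos)))) (E n (λ x → f (pos ∷ (x [ j ]≔ neg))))
                          (E n (λ x → f (neg ∷ (x [ j ]≔ pos)))) (E n (λ x → f (neg ∷ (x [ j ]≔ neg)))))
  where
  mean-interchange : ∀ a b c d → mean (mean a b) (mean c d) ≡ mean (mean a c) (mean b d)
  mean-interchange = solve 4 (λ a b c d → con ½ :* (con ½ :* (a :+ b) :+ con ½ :* (c :+ d))
                                        := con ½ :* (con ½ :* (a :+ c) :+ con ½ :* (b :+ d))) refl

Cov-sym : ∀ n (f h : Fun n) → Cov n f h ≡ Cov n h f
Cov-sym n f h = E-cong n (λ x → *-comm (f x - E n f) (h x - E n h))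

Var-cong : ∀ n {f g : Fun n} → (∀ x → f x ≡ g x) → Var n f ≡ Var n g
Var-cong n f≗g = E-cong n (λ x → cong₂ (λ a m → (a - m) * (a - m)) (f≗g x) (E-cong n f≗g))

Var-const : ∀ n c → Var n (λ _ → c) ≡ 0ℚ
Var-const n c = trans (E-cong n (λ x → cong (λ m → sq (c - m)) (E-const n c)))
  (trans (E-const n (sq (c - c))) (solve 1 (λ c → (c :- c) :* (c :- c) := con 0ℚ) refl c))

E-½+½ : ∀ n (f g : Fun n) → E n (λ x → ½ * f x + ½ * g x) ≡ ½ * E n f + ½ * E n g
E-½+½ n f g = trans (E-+ n (λ x → ½ * f x) (λ x → ½ * g x)) (cong₂ _+_ (E-scale n ½ f) (E-scale n ½ g))

-- Cov[f,h] ≤ ½Var[f] + ½Var[h], from  ab ≤ ½a² + ½b²  pointwise.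
Cov≤½Var+½Var : ∀ n (f h : Fun n) → Cov n f h ≤ ½ * Var n f + ½ * Var n h
Cov≤½Var+½Var n f h = subst (Cov n f h ≤_) (E-½+½ n (λ x → sq (f̃ x)) (λ x → sq (h̃ x)))
  (E-mono n _ _ (λ x → ≤-by-slack (½ * sq (f̃ x - h̃ x)) (am-gm (f̃ x) (h̃ x))
                                  (*-nonneg ½-nonneg (sq-nonneg (f̃ x - h̃ x)))))
  where
  f̃ h̃ : Fun n
  f̃ x = f x - E n f
  h̃ x = h x - E n h
  am-gm : ∀ a b → ½ * sq a + ½ * sq b ≡ a * b + ½ * sq (a - b)
  am-gm = solve 2 (λ a b → con ½ :* (a :* a) :+ con ½ :* (b :* b) := a :* b :+ con ½ :* ((a :- b) :* (a :- b))) refl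

Var-mean≤ : ∀ n (A B : Fun n) → Var n (λ x → mean (A x) (B x)) ≤ ½ * Var n A + ½ * Var n B
Var-mean≤ n A B = subst₂ _≤_
  (E-cong n (λ x → cong (λ m → sq (mean (A x) (B x) - m))
    (sym (trans (E-scale n ½ (λ x → A x + B x)) (cong (½ *_) (E-+ n A B))))))
  (E-½+½ n (λ x → sq (A x - E n A)) (λ x → sq (B x - E n B)))
  (E-mono n _ _ (λ x → ≤-by-slack (½ * (½ * sq ((A x - E n A) - (B x - E n B))))
     (sym (midpoint-square (A x) (B x) (E n A) (E n B)))
     (*-nonneg ½-nonneg (*-nonneg ½-nonneg (sq-nonneg ((A x - E n A) - (B x - E n B)))))))
  where
  midpoint-square : ∀ a b ma mb → sq (mean a b - mean ma mb) + ½ * (½ * sq ((a - ma) - (b - mb)))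
                                   ≡ ½ * sq (a - ma) + ½ * sq (b - mb)
  midpoint-square = solve 4 (λ a b ma mb →
    (con ½ :* (a :+ b) :- con ½ :* (ma :+ mb)) :* (con ½ :* (a :+ b) :- con ½ :* (ma :+ mb))
      :+ con ½ :* (con ½ :* (((a :- ma) :- (b :- mb)) :* ((a :- ma) :- (b :- mb))))
    := con ½ :* ((a :- ma) :* (a :- ma)) :+ con ½ :* ((b :- mb) :* (b :- mb))) refl

E-sq-shift : ∀ n (A : Fun n) c → E n (λ x → sq (A x - c)) ≡ Var n A + sq (E n A - c)
E-sq-shift n A c = begin
  E n (λ x → sq (A x - c))
    ≡⟨ E-cong n (λ x → expand (A x) m c) ⟩
  E n (λ x → sq (A x - m) + (s * A x + t))
    ≡⟨ E-+ n (λ x → sq (A x - m)) (λ x → s * A x + t) ⟩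
  Var n A + E n (λ x → s * A x + t)
    ≡⟨ cong (_+_ (Var n A)) (trans (E-+ n (λ x → s * A x) (λ _ → t)) (cong₂ _+_ (E-scale n s A) (E-const n t))) ⟩
  Var n A + (s * m + t)
    ≡⟨ cong (_+_ (Var n A)) (collapse m c) ⟩
  Var n A + sq (m - c) ∎
  where
  open ≡-Reasoning
  m s t : ℚ
  m = E n A
  s = (m - c) + (m - c)
  t = c * c - m * m
  expand : ∀ a m c → sq (a - c) ≡ sq (a - m) + (((m - c) + (m - c)) * a + (c * c - m * m))
  expand = solve 3 (λ a m c → (a :- c) :* (a :- c)
    := (a :- m) :* (a :- m) :+ (((m :- c) :+ (m :- c)) :* a :+ (c :* c :- m :* m))) refl
  collapse : ∀ m c → ((m - c) + (m - c)) * m + (c * c - m * m) ≡ sq (m - c)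
  collapse = solve 2 (λ m c → ((m :- c) :+ (m :- c)) :* m :+ (c :* c :- m :* m) := (m :- c) :* (m :- c)) refl

Ignores : ∀ {n} → Fin n → Fun n → Set
Ignores j f = ∀ x b → f (x [ j ]≔ b) ≡ f x

avg : ∀ {n} → Fin n → Fun n → Fun n
avg j f x = mean (f (x [ j ]≔ pos)) (f (x [ j ]≔ neg))

select : PM → ℚ → ℚ → ℚ
select pos a b = a
select neg a b = b

branch : ∀ {n} → Fin n → Fun n → Fun n → Fun n
branch j A B x = select (lookup x j) (A x) (B x)

-- The squared half-difference of means; the variance a single branching adds.
gap : ∀ n → Fun n → Fun n → ℚ
gap n A B = sq (½ * (E n A - E n B))

gap-nonneg : ∀ n (A B : Fun n) → 0ℚ ≤ gap n A B
gap-nonneg n A B = sq-nonneg (½ * (E n A - E n B))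

E-avg : ∀ n j (f : Fun n) → E n (avg j f) ≡ E n f
E-avg n j f = trans (E-scale n ½ (λ x → f (x [ j ]≔ pos) + f (x [ j ]≔ neg)))
  (trans (cong (½ *_) (E-+ n (λ x → f (x [ j ]≔ pos)) (λ x → f (x [ j ]≔ neg)))) (sym (E-split n j f)))

E-*-avg : ∀ n j (f g : Fun n) → Ignores j g → E n (λ x → f x * g x) ≡ E n (λ x → avg j f x * g x)
E-*-avg n j f g g-ignores = begin
  E n (λ x → f x * g x)
    ≡⟨ E-split n j _ ⟩
  mean (E n (λ x → f (x [ j ]≔ pos) * g (x [ j ]≔ pos))) (E n (λ x → f (x [ j ]≔ neg) * g (x [ j ]≔ neg)))
    ≡⟨ cong₂ mean (E-cong n (λ x → cong (f (x [ j ]≔ pos) *_) (g-ignores x pos)))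
                  (E-cong n (λ x → cong (f (x [ j ]≔ neg) *_) (g-ignores x neg))) ⟩
  mean (E n f⁺g) (E n f⁻g)
    ≡⟨ sym (trans (E-½+½ n f⁺g f⁻g) (half-sum (E n f⁺g) (E n f⁻g))) ⟩
  E n (λ x → ½ * f⁺g x + ½ * f⁻g x)
    ≡⟨ sym (E-cong n (λ x → distribute (f (x [ j ]≔ pos)) (f (x [ j ]≔ neg)) (g x))) ⟩
  E n (λ x → avg j f x * g x) ∎
  where
  open ≡-Reasoning
  f⁺g f⁻g : Fun n
  f⁺g x = f (x [ j ]≔ pos) * g x
  f⁻g x = f (x [ j ]≔ neg) * g x
  half-sum : ∀ a b → ½ * a + ½ * b ≡ mean a b
  half-sum = solve 2 (λ a b → con ½ :* a :+ con ½ :* b := con ½ :* (a :+ b)) refl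
  distribute : ∀ a b c → mean a b * c ≡ ½ * (a * c) + ½ * (b * c)
  distribute = solve 3 (λ a b c → con ½ :* (a :+ b) :* c := con ½ :* (a :* c) :+ con ½ :* (b :* c)) refl

Cov-avg : ∀ n j (f h : Fun n) → Ignores j h → Cov n f h ≡ Cov n (avg j f) h
Cov-avg n j f h h-ignores =
  trans (E-*-avg n j (λ x → f x - E n f) (λ x → h x - E n h) (λ x b → cong (_- E n h) (h-ignores x b)))
        (E-cong n (λ x → cong (_* (h x - E n h))
           (trans (mean-shift (f (x [ j ]≔ pos)) (f (x [ j ]≔ neg)) (E n f))
                  (cong (_-_ (avg j f x)) (sym (E-avg n j f))))))
  where
  mean-shift : ∀ a b c → mean (a - c) (b - c) ≡ mean a b - c
  mean-shift = solve 3 (λ a b c → con ½ :* ((a :- c) :+ (b :- c)) := con ½ :* (a :+ b) :- c) refl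

branch-pos : ∀ {n} j (A B : Fun n) x → branch j A B (x [ j ]≔ pos) ≡ A (x [ j ]≔ pos)
branch-pos j A B x rewrite VecP.lookup∘update j x pos = refl

branch-neg : ∀ {n} j (A B : Fun n) x → branch j A B (x [ j ]≔ neg) ≡ B (x [ j ]≔ neg)
branch-neg j A B x rewrite VecP.lookup∘update j x neg = refl

E-branch : ∀ n j (A B : Fun n) → Ignores j A → Ignores j B → (G : ℚ → ℚ) →
  E n (λ x → G (branch j A B x)) ≡ mean (E n (λ x → G (A x))) (E n (λ x → G (B x)))
E-branch n j A B A-ignores B-ignores G = trans (E-split n j _)
  (cong₂ mean (E-cong n (λ x → cong G (trans (branch-pos j A B x) (A-ignores x pos))))
              (E-cong n (λ x → cong G (trans (branch-neg j A B x) (B-ignores x neg)))))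

Var-branch : ∀ n j (A B : Fun n) → Ignores j A → Ignores j B →
  Var n (branch j A B) ≡ ½ * Var n A + ½ * Var n B + gap n A B
Var-branch n j A B A-ignores B-ignores = begin
  Var n (branch j A B)
    ≡⟨ E-branch n j A B A-ignores B-ignores (λ t → sq (t - m)) ⟩
  mean (E n (λ x → sq (A x - m))) (E n (λ x → sq (B x - m)))
    ≡⟨ cong₂ mean (E-sq-shift n A m) (E-sq-shift n B m) ⟩
  mean (Var n A + sq (E n A - m)) (Var n B + sq (E n B - m))
    ≡⟨ cong (λ c → mean (Var n A + sq (E n A - c)) (Var n B + sq (E n B - c))) m≡ ⟩
  mean (Var n A + sq (E n A - mean (E n A) (E n B))) (Var n B + sq (E n B - mean (E n A) (E n B)))
    ≡⟨ total-variance (Var n A) (Var n B) (E n A) (E n B) ⟩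
  ½ * Var n A + ½ * Var n B + gap n A B ∎
  where
  open ≡-Reasoning
  m : ℚ
  m = E n (branch j A B)
  m≡ : m ≡ mean (E n A) (E n B)
  m≡ = E-branch n j A B A-ignores B-ignores (λ t → t)
  total-variance : ∀ va vb a b → mean (va + sq (a - mean a b)) (vb + sq (b - mean a b))
                                 ≡ ½ * va + ½ * vb + sq (½ * (a - b))
  total-variance = solve 4 (λ va vb a b →
    con ½ :* ((va :+ (a :- con ½ :* (a :+ b)) :* (a :- con ½ :* (a :+ b)))
              :+ (vb :+ (b :- con ½ :* (a :+ b)) :* (b :- con ½ :* (a :+ b))))
    := con ½ :* va :+ con ½ :* vb :+ (con ½ :* (a :- b)) :* (con ½ :* (a :- b))) refl

avg-cong : ∀ {n} j {f g : Fun n} → (∀ x → f x ≡ g x) → ∀ x → avg j f x ≡ avg j g x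
avg-cong j f≗g x = cong₂ mean (f≗g _) (f≗g _)

avg-ignored : ∀ {n} j (f : Fun n) → Ignores j f → ∀ x → avg j f x ≡ f x
avg-ignored j f f-ignores x = trans (cong₂ mean (f-ignores x pos) (f-ignores x neg)) (mean-self (f x))

-- Averaging over x_j preserves independence of every x_k (for k = j by idempotence of updates).
Ignores-avg : ∀ {n} k j (f : Fun n) → Ignores k f → Ignores k (avg j f)
Ignores-avg k j f f-ignores x b with k ≟ᶠ j
... | yes refl = cong₂ (λ y z → mean (f y) (f z)) (VecP.[]≔-idempotent x k) (VecP.[]≔-idempotent x k)
... | no k≢j = cong₂ mean
  (trans (cong f (VecP.[]≔-commutes x k j k≢j)) (f-ignores (x [ j ]≔ pos) b))
  (trans (cong f (VecP.[]≔-commutes x k j k≢j)) (f-ignores (x [ j ]≔ neg) b))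

avg-mean : ∀ {n} j (A B : Fun n) x → avg j (λ y → mean (A y) (B y)) x ≡ mean (avg j A x) (avg j B x)
avg-mean j A B x = mean-interchange (A (x [ j ]≔ pos)) (B (x [ j ]≔ pos)) (A (x [ j ]≔ neg)) (B (x [ j ]≔ neg))
  where
  mean-interchange : ∀ a b c d → mean (mean a b) (mean c d) ≡ mean (mean a c) (mean b d)
  mean-interchange = solve 4 (λ a b c d → con ½ :* (con ½ :* (a :+ b) :+ con ½ :* (c :+ d))
                                        := con ½ :* (con ½ :* (a :+ c) :+ con ½ :* (b :+ d))) refl

avg-branch-self : ∀ {n} j (A B : Fun n) → Ignores j A → Ignores j B →
  ∀ x → avg j (branch j A B) x ≡ mean (A x) (B x)
avg-branch-self j A B A-ignores B-ignores x = cong₂ mean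
  (trans (branch-pos j A B x) (A-ignores x pos)) (trans (branch-neg j A B x) (B-ignores x neg))

avg-branch-other : ∀ {n} i j (A B : Fun n) → i ≢ j →
  ∀ x → avg i (branch j A B) x ≡ branch j (avg i A) (avg i B) x
avg-branch-other i j A B i≢j x
  rewrite VecP.lookup∘update′ (λ j≡i → i≢j (sym j≡i)) x pos
        | VecP.lookup∘update′ (λ j≡i → i≢j (sym j≡i)) x neg
  with lookup x j
... | pos = refl
... | neg = refl

avgOver : ∀ {n} → List (Fin n) → Fun n → Fun n
avgOver [] f = f
avgOver (j ∷ J) f = avg j (avgOver J f)

avgOver-cong : ∀ {n} (J : List (Fin n)) {f g : Fun n} → (∀ x → f x ≡ g x) → ∀ x → avgOver J f x ≡ avgOver J g x
avgOver-cong [] f≗g = f≗g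
avgOver-cong (j ∷ J) f≗g = avg-cong j (avgOver-cong J f≗g)

E-avgOver : ∀ n (J : List (Fin n)) f → E n (avgOver J f) ≡ E n f
E-avgOver n [] f = refl
E-avgOver n (j ∷ J) f = trans (E-avg n j (avgOver J f)) (E-avgOver n J f)

Ignores-avgOver : ∀ {n} k (J : List (Fin n)) (f : Fun n) → Ignores k f → Ignores k (avgOver J f)
Ignores-avgOver k [] f f-ignores = f-ignores
Ignores-avgOver k (j ∷ J) f f-ignores = Ignores-avg k j (avgOver J f) (Ignores-avgOver k J f f-ignores)

avgOver-const : ∀ {n} (J : List (Fin n)) c x → avgOver J (λ _ → c) x ≡ c
avgOver-const [] c x = refl
avgOver-const (j ∷ J) c x = trans (avg-cong j (avgOver-const J c) x) (mean-self c)

Cov-avgOver : ∀ n (J : List (Fin n)) (f h : Fun n) → (∀ {j} → j ∈ J → Ignores j h) →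
  Cov n f h ≡ Cov n (avgOver J f) h
Cov-avgOver n [] f h _ = refl
Cov-avgOver n (j ∷ J) f h h-ignores =
  trans (Cov-avgOver n J f h (λ j∈J → h-ignores (there j∈J))) (Cov-avg n j (avgOver J f) h (h-ignores (here refl)))

module _ {n} (j : Fin n) (A B : Fun n) (A-ignores : Ignores j A) (B-ignores : Ignores j B) where
  open DecMembership (_≟ᶠ_ {n}) using (_∈?_)

  avgOver-branch-∉ : ∀ J → ¬ j ∈ J → ∀ x → avgOver J (branch j A B) x ≡ branch j (avgOver J A) (avgOver J B) x
  avgOver-branch-∉ [] _ x = refl
  avgOver-branch-∉ (i ∷ J) j∉ x = trans (avg-cong i (avgOver-branch-∉ J (λ j∈J → j∉ (there j∈J))) x)
    (avg-branch-other i j (avgOver J A) (avgOver J B) (λ i≡j → j∉ (here (sym i≡j))) x)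

  avgOver-branch-∈ : ∀ J → j ∈ J → ∀ x → avgOver J (branch j A B) x ≡ mean (avgOver J A x) (avgOver J B x)
  avgOver-branch-∈ (i ∷ J) (there j∈J) x =
    trans (avg-cong i (avgOver-branch-∈ J j∈J) x) (avg-mean i (avgOver J A) (avgOver J B) x)
  avgOver-branch-∈ (i ∷ J) (here refl) x with j ∈? J
  ... | yes j∈J = trans (avg-cong i (avgOver-branch-∈ J j∈J) x) (avg-mean i (avgOver J A) (avgOver J B) x)
  ... | no j∉J = begin
    avg j (avgOver J (branch j A B)) x
      ≡⟨ avg-cong j (avgOver-branch-∉ J j∉J) x ⟩
    avg j (branch j A' B') x
      ≡⟨ avg-branch-self j A' B' A'-ignores B'-ignores x ⟩
    mean (A' x) (B' x)
      ≡⟨ sym (cong₂ mean (avg-ignored j A' A'-ignores x) (avg-ignored j B' B'-ignores x)) ⟩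
    mean (avg j A' x) (avg j B' x) ∎
    where
    open ≡-Reasoning
    A' B' : Fun n
    A' = avgOver J A
    B' = avgOver J B
    A'-ignores : Ignores j A'
    A'-ignores = Ignores-avgOver j J A A-ignores
    B'-ignores : Ignores j B'
    B'-ignores = Ignores-avgOver j J B B-ignores

  -- The node step of the averaged-variance bound: the gap term survives only if j ∉ J,
  -- so any weight c ≥ 0 that is ≥ 1 when j ∉ J may be put in front of it.
  Var-avgOver-branch≤ : ∀ J c → 0ℚ ≤ c → (¬ j ∈ J → 1ℚ ≤ c) →
    Var n (avgOver J (branch j A B)) ≤ ½ * Var n (avgOver J A) + ½ * Var n (avgOver J B) + c * gap n A B
  Var-avgOver-branch≤ J c 0≤c c≥1 with j ∈? J
  ... | yes j∈J = begin
    Var n (avgOver J (branch j A B))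
      ≡⟨ Var-cong n (avgOver-branch-∈ J j∈J) ⟩
    Var n (λ x → mean (avgOver J A x) (avgOver J B x))
      ≤⟨ Var-mean≤ n (avgOver J A) (avgOver J B) ⟩
    ½ * Var n (avgOver J A) + ½ * Var n (avgOver J B)
      ≤⟨ ≤-+-nonneg-product _ 0≤c (gap-nonneg n A B) ⟩
    ½ * Var n (avgOver J A) + ½ * Var n (avgOver J B) + c * gap n A B ∎
    where open ≤-Reasoning
  ... | no j∉J = begin
    Var n (avgOver J (branch j A B))
      ≡⟨ Var-cong n (avgOver-branch-∉ J j∉J) ⟩
    Var n (branch j (avgOver J A) (avgOver J B))
      ≡⟨ Var-branch n j (avgOver J A) (avgOver J B) (Ignores-avgOver j J A A-ignores) (Ignores-avgOver j J B B-ignores) ⟩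
    ½ * Var n (avgOver J A) + ½ * Var n (avgOver J B) + gap n (avgOver J A) (avgOver J B)
      ≡⟨ cong (λ g → ½ * Var n (avgOver J A) + ½ * Var n (avgOver J B) + g)
              (cong₂ (λ a b → sq (½ * (a - b))) (E-avgOver n J A) (E-avgOver n J B)) ⟩
    ½ * Var n (avgOver J A) + ½ * Var n (avgOver J B) + gap n A B
      ≤⟨ +-monoʳ-≤ (½ * Var n (avgOver J A) + ½ * Var n (avgOver J B))
           (subst (_≤ c * gap n A B) (*-identityˡ (gap n A B))
             (*-monoʳ-≤-nonNeg (gap n A B) {{nonNegative (gap-nonneg n A B)}} (c≥1 j∉J))) ⟩
    ½ * Var n (avgOver J A) + ½ * Var n (avgOver J B) + c * gap n A B ∎
    where open ≤-Reasoning

ev : ∀ {n} → DT n → Fun n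
ev T x = toℚ (eval T x)

ev-node : ∀ {n} j (l r : DT n) x → ev (node j l r) x ≡ branch j (ev l) (ev r) x
ev-node j l r x with lookup x j
... | pos = refl
... | neg = refl

unqueried-ignored : ∀ {n} j (T : DT n) → ¬ Queries j T → Ignores j (ev T)
unqueried-ignored j (leaf b) _ x c = refl
unqueried-ignored j (node i l r) j∉T x c = begin
  ev (node i l r) (x [ j ]≔ c)
    ≡⟨ ev-node i l r (x [ j ]≔ c) ⟩
  select (lookup (x [ j ]≔ c) i) (ev l (x [ j ]≔ c)) (ev r (x [ j ]≔ c))
    ≡⟨ cong (λ p → select p (ev l (x [ j ]≔ c)) (ev r (x [ j ]≔ c))) (VecP.lookup∘update′ i≢j x c) ⟩
  select (lookup x i) (ev l (x [ j ]≔ c)) (ev r (x [ j ]≔ c))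
    ≡⟨ cong₂ (select (lookup x i)) (unqueried-ignored j l (λ q → j∉T (left q)) x c)
                                   (unqueried-ignored j r (λ q → j∉T (right q)) x c) ⟩
  select (lookup x i) (ev l x) (ev r x)
    ≡⟨ sym (ev-node i l r x) ⟩
  ev (node i l r) x ∎
  where
  open ≡-Reasoning
  i≢j : i ≢ j
  i≢j i≡j = j∉T (subst (λ k → Queries k (node i l r)) i≡j here)

count0⇒unqueried : ∀ {n} i (T : DT n) → count i T ≡ 0 → ¬ Queries i T
count0⇒unqueried i (node .i l r) count≡0 here with i ≟ᶠ i
count0⇒unqueried i (node .i l r) () here | yes _
... | no i≢i = i≢i refl
count0⇒unqueried i (node j l r) count≡0 (left q) with i ≟ᶠ j
count0⇒unqueried i (node j l r) () (left q) | yes _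
... | no _ = count0⇒unqueried i l (ℕP.m+n≡0⇒m≡0 (count i l) count≡0) q
count0⇒unqueried i (node j l r) count≡0 (right q) with i ≟ᶠ j
count0⇒unqueried i (node j l r) () (right q) | yes _
... | no _ = count0⇒unqueried i r (ℕP.m+n≡0⇒n≡0 (count i l) count≡0) q

count-node≥ : ∀ {n} i j (l r : DT n) → count i l ℕ.+ count i r ℕ.≤ count i (node j l r)
count-node≥ i j l r with i ≟ᶠ j
... | yes _ = ℕP.n≤1+n _
... | no _ = ℕP.≤-refl

count-root : ∀ {n} j (l r : DT n) → 1 ℕ.≤ count j (node j l r)
count-root j l r with j ≟ᶠ j
... | yes _ = ℕ.s≤s ℕ.z≤n
... | no j≢j = ⊥-elim (j≢j refl)

WVar : ∀ {n} → (Fin n → ℚ) → DT n → ℚ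
WVar w (leaf b) = 0ℚ
WVar {n} w (node j L R) = ½ * WVar w L + ½ * WVar w R + w j * gap n (ev L) (ev R)

WVar-mono : ∀ {n} (w w' : Fin n → ℚ) → (∀ i → w i ≤ w' i) → ∀ T → WVar w T ≤ WVar w' T
WVar-mono w w' w≤w' (leaf b) = ≤-refl
WVar-mono {n} w w' w≤w' (node j L R) =
  +-mono-≤ (+-mono-≤ (½*-mono (WVar-mono w w' w≤w' L)) (½*-mono (WVar-mono w w' w≤w' R)))
           (*-monoʳ-≤-nonNeg (gap n (ev L) (ev R)) {{nonNegative (gap-nonneg n (ev L) (ev R))}} (w≤w' j))

WVar-+ : ∀ {n} (w w' : Fin n → ℚ) T → WVar (λ i → w i + w' i) T ≡ WVar w T + WVar w' T
WVar-+ w w' (leaf b) = sym (+-identityˡ 0ℚ)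
WVar-+ {n} w w' (node j L R) =
  trans (cong₂ (λ a b → ½ * a + ½ * b + (w j + w' j) * gap n (ev L) (ev R)) (WVar-+ w w' L) (WVar-+ w w' R))
        (regroup (w j) (w' j) (gap n (ev L) (ev R)) (WVar w L) (WVar w' L) (WVar w R) (WVar w' R))
  where
  regroup : ∀ a b d x x' y y' → ½ * (x + x') + ½ * (y + y') + (a + b) * d
                                ≡ (½ * x + ½ * y + a * d) + (½ * x' + ½ * y' + b * d)
  regroup = solve 7 (λ a b d x x' y y' → con ½ :* (x :+ x') :+ con ½ :* (y :+ y') :+ (a :+ b) :* d
     := (con ½ :* x :+ con ½ :* y :+ a :* d) :+ (con ½ :* x' :+ con ½ :* y' :+ b :* d)) refl

WVar-const : ∀ {n} c (T : DT n) → WVar (λ _ → c) T ≡ c * WVar (λ _ → 1ℚ) T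
WVar-const c (leaf b) = sym (*-zeroʳ c)
WVar-const {n} c (node j L R) =
  trans (cong₂ (λ a b → ½ * a + ½ * b + c * gap n (ev L) (ev R)) (WVar-const c L) (WVar-const c R))
        (factor c (gap n (ev L) (ev R)) (WVar (λ _ → 1ℚ) L) (WVar (λ _ → 1ℚ) R))
  where
  factor : ∀ c d x y → ½ * (c * x) + ½ * (c * y) + c * d ≡ c * (½ * x + ½ * y + 1ℚ * d)
  factor = solve 4 (λ c d x y → con ½ :* (c :* x) :+ con ½ :* (c :* y) :+ c :* d
     := c :* (con ½ :* x :+ con ½ :* y :+ con 1ℚ :* d)) refl

Var≡WVar1 : ∀ {n} (T : DT n) → NoRepeat T → Var n (ev T) ≡ WVar (λ _ → 1ℚ) T
Var≡WVar1 {n} (leaf b) _ = Var-const n (toℚ b)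
Var≡WVar1 {n} (node j L R) (node j∉L j∉R L-ok R-ok) = begin
  Var n (ev (node j L R))
    ≡⟨ Var-cong n (ev-node j L R) ⟩
  Var n (branch j (ev L) (ev R))
    ≡⟨ Var-branch n j (ev L) (ev R) (unqueried-ignored j L j∉L) (unqueried-ignored j R j∉R) ⟩
  ½ * Var n (ev L) + ½ * Var n (ev R) + gap n (ev L) (ev R)
    ≡⟨ cong₂ (λ a b → ½ * a + ½ * b + gap n (ev L) (ev R)) (Var≡WVar1 L L-ok) (Var≡WVar1 R R-ok) ⟩
  ½ * WVar (λ _ → 1ℚ) L + ½ * WVar (λ _ → 1ℚ) R + gap n (ev L) (ev R)
    ≡⟨ cong (_+_ (½ * WVar (λ _ → 1ℚ) L + ½ * WVar (λ _ → 1ℚ) R)) (sym (*-identityˡ (gap n (ev L) (ev R)))) ⟩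
  WVar (λ _ → 1ℚ) (node j L R) ∎
  where open ≡-Reasoning

-- Averaging a tree over J erases exactly the gap terms of nodes reading a
-- variable of J, so its variance is at most WVar w for any weights w ≥ 0
-- that are ≥ 1 off J.
Var-avgOver≤WVar : ∀ {n} (J : List (Fin n)) (w : Fin n → ℚ) →
  (∀ i → 0ℚ ≤ w i) → (∀ i → ¬ i ∈ J → 1ℚ ≤ w i) →
  ∀ T → NoRepeat T → Var n (avgOver J (ev T)) ≤ WVar w T
Var-avgOver≤WVar {n} J w w≥0 w≥1 (leaf b) _ =
  ≤-reflexive (trans (Var-cong n (avgOver-const J (toℚ b))) (Var-const n (toℚ b)))
Var-avgOver≤WVar {n} J w w≥0 w≥1 (node j L R) (node j∉L j∉R L-ok R-ok) = begin
  Var n (avgOver J (ev (node j L R)))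
    ≡⟨ Var-cong n (avgOver-cong J (ev-node j L R)) ⟩
  Var n (avgOver J (branch j (ev L) (ev R)))
    ≤⟨ Var-avgOver-branch≤ j (ev L) (ev R) (unqueried-ignored j L j∉L) (unqueried-ignored j R j∉R)
                           J (w j) (w≥0 j) (w≥1 j) ⟩
  ½ * Var n (avgOver J (ev L)) + ½ * Var n (avgOver J (ev R)) + w j * gap n (ev L) (ev R)
    ≤⟨ +-monoˡ-≤ (w j * gap n (ev L) (ev R))
         (+-mono-≤ (½*-mono (Var-avgOver≤WVar J w w≥0 w≥1 L L-ok)) (½*-mono (Var-avgOver≤WVar J w w≥0 w≥1 R R-ok))) ⟩
  WVar w (node j L R) ∎
  where open ≤-Reasoning

reads : ∀ {n} → DT n → Fin n → ℚ
reads T i = ι (count i T)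

unread : ∀ {n} → DT n → List (Fin n)
unread {n} h = filter (λ i → count i h ℕ.≟ 0) (allFin n)

unread-ignored : ∀ {n} (h : DT n) {j} → j ∈ unread h → Ignores j (ev h)
unread-ignored {n} h {j} j∈ = unqueried-ignored j h
  (count0⇒unqueried j h (proj₂ (∈-filter⁻ (λ i → count i h ℕ.≟ 0) {xs = allFin n} j∈)))

reads≥1-off-unread : ∀ {n} (h : DT n) i → ¬ i ∈ unread h → 1ℚ ≤ reads h i
reads≥1-off-unread h i i∉ with count i h in count≡
... | zero = ⊥-elim (i∉ (∈-filter⁺ (λ i → count i h ℕ.≟ 0) (∈-allFin i) count≡))
... | suc c = ι-positive {suc c} (ℕ.s≤s ℕ.z≤n)

Var-avg-unread≤ : ∀ {n} (g h : DT n) → NoRepeat g → Var n (avgOver (unread h) (ev g)) ≤ WVar (reads h) g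
Var-avg-unread≤ g h g-ok =
  Var-avgOver≤WVar (unread h) (reads h) (λ i → ι-nonneg (count i h)) (reads≥1-off-unread h) g g-ok

Cov-trees≤ : ∀ {n} (g h : DT n) → NoRepeat g → NoRepeat h →
  Cov n (ev g) (ev h) ≤ ½ * WVar (reads h) g + ½ * WVar (reads g) h
Cov-trees≤ {n} g h g-ok h-ok = begin
  Cov n (ev g) (ev h)
    ≡⟨ Cov-avgOver n (unread h) (ev g) (ev h) (unread-ignored h) ⟩
  Cov n g̃ (ev h)
    ≡⟨ Cov-sym n g̃ (ev h) ⟩
  Cov n (ev h) g̃
    ≡⟨ Cov-avgOver n (unread g) (ev h) g̃ (λ {j} j∈ → Ignores-avgOver j (unread h) (ev g) (unread-ignored g j∈)) ⟩
  Cov n h̃ g̃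
    ≡⟨ Cov-sym n h̃ g̃ ⟩
  Cov n g̃ h̃
    ≤⟨ Cov≤½Var+½Var n g̃ h̃ ⟩
  ½ * Var n g̃ + ½ * Var n h̃
    ≤⟨ +-mono-≤ (½*-mono (Var-avg-unread≤ g h g-ok)) (½*-mono (Var-avg-unread≤ h g h-ok)) ⟩
  ½ * WVar (reads h) g + ½ * WVar (reads g) h ∎
  where
  open ≤-Reasoning
  g̃ h̃ : Fun n
  g̃ = avgOver (unread h) (ev g)
  h̃ = avgOver (unread g) (ev h)

CovAt-suc : ∀ {n} d (T : DT n) → CovAt (suc d) T ≡ ½ * CovAt d T
CovAt-suc d (leaf b) = sym (*-zeroʳ ½)
CovAt-suc {n} d (node j l r) =
  trans (cong₂ (λ a b → C * (½ * (½ ^ d)) + a + b) (CovAt-suc (suc d) l) (CovAt-suc (suc d) r))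
        (factor-½ C (½ ^ d) (CovAt (suc d) l) (CovAt (suc d) r))
  where
  C : ℚ
  C = Cov n (ev l) (ev r)
  factor-½ : ∀ C p a b → C * (½ * p) + ½ * a + ½ * b ≡ ½ * (C * p + a + b)
  factor-½ = solve 4 (λ C p a b → C :* (con ½ :* p) :+ con ½ :* a :+ con ½ :* b := con ½ :* (C :* p :+ a :+ b)) refl

excess : ∀ {n} → DT n → Fin n → ℚ
excess T i = reads T i - 1ℚ

-- (a - 1) + b ≤ c - 1 in ℚ whenever a + b ≤ c in ℕ: the reads of a subtree's
-- sibling fit into the excess reads of the whole tree.
excess-+ : ∀ a b {c} → a ℕ.+ b ℕ.≤ c → (ι a - 1ℚ) + ι b ≤ ι c - 1ℚ
excess-+ a b a+b≤c = subst (_≤ _) (sym (trans (move-1 (ι a) (ι b)) (cong (_- 1ℚ) (sym (ι-+ a b)))))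
  (+-monoˡ-≤ (- 1ℚ) (ι-mono a+b≤c))
  where
  move-1 : ∀ x y → (x - 1ℚ) + y ≡ (x + y) - 1ℚ
  move-1 = solve 2 (λ x y → (x :- con 1ℚ) :+ y := (x :+ y) :- con 1ℚ) refl

CovT≤WVar-excess : ∀ {n} (T : DT n) → NoRepeat T → CovT T ≤ WVar (excess T) T
CovT≤WVar-excess (leaf b) _ = ≤-refl
CovT≤WVar-excess {n} (node j L R) (node _ _ L-ok R-ok) = begin
  C * 1ℚ + CovAt 1 L + CovAt 1 R
    ≡⟨ cong₂ (λ a b → C * 1ℚ + a + b) (CovAt-suc 0 L) (CovAt-suc 0 R) ⟩
  C * 1ℚ + ½ * CovT L + ½ * CovT R
    ≤⟨ +-mono-≤ (+-mono-≤ (≤-reflexive (*-identityʳ C)) (½*-mono (CovT≤WVar-excess L L-ok)))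
                (½*-mono (CovT≤WVar-excess R R-ok)) ⟩
  C + ½ * WVar (excess L) L + ½ * WVar (excess R) R
    ≤⟨ +-monoˡ-≤ _ (+-monoˡ-≤ _ (Cov-trees≤ L R L-ok R-ok)) ⟩
  (½ * WVar (reads R) L + ½ * WVar (reads L) R) + ½ * WVar (excess L) L + ½ * WVar (excess R) R
    ≡⟨ regroup (WVar (reads R) L) (WVar (reads L) R) (WVar (excess L) L) (WVar (excess R) R) ⟩
  ½ * (WVar (excess L) L + WVar (reads R) L) + ½ * (WVar (excess R) R + WVar (reads L) R)
    ≡⟨ sym (cong₂ (λ a b → ½ * a + ½ * b) (WVar-+ (excess L) (reads R) L) (WVar-+ (excess R) (reads L) R)) ⟩
  ½ * WVar (λ i → excess L i + reads R i) L + ½ * WVar (λ i → excess R i + reads L i) R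
    ≤⟨ +-mono-≤ (½*-mono (WVar-mono _ _ left-fits L)) (½*-mono (WVar-mono _ _ right-fits R)) ⟩
  ½ * WVar (excess T) L + ½ * WVar (excess T) R
    ≤⟨ ≤-+-nonneg-product _ excess-root≥0 (gap-nonneg n (ev L) (ev R)) ⟩
  WVar (excess T) T ∎
  where
  open ≤-Reasoning
  T : DT n
  T = node j L R
  C : ℚ
  C = Cov n (ev L) (ev R)
  regroup : ∀ c d x y → (½ * c + ½ * d) + ½ * x + ½ * y ≡ ½ * (x + c) + ½ * (y + d)
  regroup = solve 4 (λ c d x y → (con ½ :* c :+ con ½ :* d) :+ con ½ :* x :+ con ½ :* y
     := con ½ :* (x :+ c) :+ con ½ :* (y :+ d)) refl
  left-fits : ∀ i → excess L i + reads R i ≤ excess T i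
  left-fits i = excess-+ (count i L) (count i R) (count-node≥ i j L R)
  right-fits : ∀ i → excess R i + reads L i ≤ excess T i
  right-fits i = excess-+ (count i R) (count i L) (subst (ℕ._≤ count i T) (ℕP.+-comm (count i L) (count i R)) (count-node≥ i j L R))
  excess-root≥0 : 0ℚ ≤ excess T j
  excess-root≥0 = ≤⇒0≤difference (ι-positive (count-root j L R))

lemma1p8 : (n k : ℕ) (T : DT n) (f : Vec PM n → PM) →
    NoRepeat T → ReadK k T → (∀ x → eval T x ≡ f x) →
    CovT T ≤ ((+ k) / 1 - 1ℚ) * Var n (λ x → toℚ (f x))
lemma1p8 n k T f T-ok read-k T≗f = begin
  CovT T
    ≤⟨ CovT≤WVar-excess T T-ok ⟩
  WVar (excess T) T
    ≤⟨ WVar-mono (excess T) (λ _ → ι k - 1ℚ) (λ i → +-monoˡ-≤ (- 1ℚ) (ι-mono (read-k i))) T ⟩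
  WVar (λ _ → ι k - 1ℚ) T
    ≡⟨ WVar-const (ι k - 1ℚ) T ⟩
  (ι k - 1ℚ) * WVar (λ _ → 1ℚ) T
    ≡⟨ cong ((ι k - 1ℚ) *_) (sym (Var≡WVar1 T T-ok)) ⟩
  (ι k - 1ℚ) * Var n (ev T)
    ≡⟨ cong₂ (λ c v → (c - 1ℚ) * v) (ι≡fromℕ k) (Var-cong n (λ x → cong toℚ (T≗f x))) ⟩
  ((+ k) / 1 - 1ℚ) * Var n (λ x → toℚ (f x)) ∎
  where open ≤-Reasoning
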